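{- For every integer $n \geq 3$, the graph $C_n \star S_7$ is coprime.
   Context: A graph $G$ with $N$ vertices is \emph{coprime} (has a prime vertex labeling) if there is a bijection $f: V(G) \to \{1,2,\ldots,N\}$ such that $\gcd(f(u),f(v)) = 1$ for every edge $uv$ of $G$. For integers $n \geq 3$ and $m \geq 1$, the \emph{$m$-hairy $n$-cycle} $C_n \star S_m$ is the graph obtained from the cycle $C_n$ by attaching $m$ pendant vertices (vertices of degree one) to each cycle vertex; it has $(m+1)n$ vertices. -}

module Defs where

open import Data.Nat using (ℕ; zero; suc; _+_; _*_; _≤_)
open import Data.Nat.Coprimality using (Coprime)
open import Data.Fin using (Fin; toℕ; zero; suc)
open import Data.Fin.Base using (fromℕ<)
open import Data.Product using (_×_; _,_; ∃)
open import Data.Sum using (_⊎_)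
open import Function.Bundles using (_⤖_; Bijection)
open import Relation.Binary.PropositionalEquality using (_≡_)

record Graph : Set₁ where
  field
    V : Set
    E : V → V → Set

open Graph public

label : {N : ℕ} → Fin N → ℕ
label i = suc (toℕ i)

IsCoprime : (G : Graph) (N : ℕ) → Set
IsCoprime G N =
  ∃ λ (f : V G ⤖ Fin N) →
    ∀ (u v : V G) → E G u v →
      Coprime (label (Bijection.to f u)) (label (Bijection.to f v))

sucMod : {n : ℕ} → Fin n → Fin n
sucMod {suc zero} zero = zero
sucMod {suc (suc n)} zero = suc zero
sucMod {suc (suc n)} (suc i) with sucMod {suc n} i
... | zero = zero
... | suc j = suc (suc j)

-- Vertices of C_n ⋆ S_m: (i , zero) is the i-th cycle vertex,
-- (i , suc j) is the j-th pendant vertex attached to cycle vertex i.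
-- Edge relation (directed form; made symmetric in HairyCycle).
data HairyArc (n m : ℕ) : Fin n × Fin (suc m) → Fin n × Fin (suc m) → Set where
  cycleArc   : ∀ i → HairyArc n m (i , zero) (sucMod i , zero)
  pendantArc : ∀ i (j : Fin m) → HairyArc n m (i , zero) (i , suc j)

HairyCycle : (n m : ℕ) → Graph
HairyCycle n m = record
  { V = Fin n × Fin (suc m)
  ; E = λ u v → HairyArc n m u v ⊎ HairyArc n m v u
  }

-- The hub i (the i-th cycle vertex) and its seven pendants receive the block {8i+1, …, 8i+8}, the hub
-- taking an odd label of the block chosen according to i mod 3 and 8i+3 mod 5. A common divisor of two
-- labels divides their difference; along pendant edges the differences are at most 6, along cycle
-- edges they are even and at most 12, so all of them divide 120. Shifting i by 15 shifts every label
-- of the block by 120, so coprimality along the edges at i only depends on i mod 15 and is settled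
-- by a finite check.
module Submission where

open import Data.Bool using (Bool; true; false)
open import Data.Fin using (Fin; zero; suc; toℕ; fromℕ<; #_)
open import Data.Fin.Permutation using (Permutation′; transpose; cast-id; _⟨$⟩ʳ_; _⟨$⟩ˡ_; inverseˡ)
open import Data.Fin.Properties using (all?; _≟_; toℕ-fromℕ<; toℕ-cast; toℕ-combine; *↔×)
open import Data.Nat using (ℕ; zero; suc; _+_; _*_; _≤_; _∸_; _%_; _/_; _≡ᵇ_; ∣_-_∣; NonZero)
open import Data.Nat.Coprimality as Coprime using (Coprime; coprime?; 1-coprimeTo)
open import Data.Nat.DivMod using (m≡m%n+[m/n]*n; [m+kn]%n≡m%n; m%n<n)
open import Data.Nat.Divisibility using (_∣_; _∣?_; ∣-trans; n∣m*n; ∣m+n∣m⇒∣n)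
open import Data.Nat.Properties
  using (≤-total; *-comm; *-assoc; m+[n∸m]≡n; m≤n⇒∣m-n∣≡n∸m; ∣-∣-comm; ∣m+n-m+o∣≡∣n-o∣)
open import Data.Nat.Tactic.RingSolver using (solve-∀)
open import Data.Product using (_×_; _,_; proj₁)
open import Data.Product.Function.Dependent.Propositional using (Σ-↔)
open import Data.Sum using (_⊎_; inj₁; inj₂)
open import Function.Bundles using (_↔_; Inverse)
open import Function.Construct.Composition using (_↔-∘_)
open import Function.Properties.Inverse using (↔-refl; ↔-sym; ↔⇒⤖)
open import Relation.Nullary using (Dec; ¬_)
open import Relation.Nullary.Decidable using (toWitness; _×-dec_; _→-dec_; ¬?)
open import Relation.Binary.PropositionalEquality

open import Defs

∣m∣n⇒∣n∸m : ∀ {d m n} → m ≤ n → d ∣ m → d ∣ n → d ∣ n ∸ m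
∣m∣n⇒∣n∸m {d} m≤n d∣m d∣n = ∣m+n∣m⇒∣n (subst (d ∣_) (sym (m+[n∸m]≡n m≤n)) d∣n) d∣m

∣m∣n⇒∣∣m-n∣ : ∀ {d m n} → d ∣ m → d ∣ n → d ∣ ∣ m - n ∣
∣m∣n⇒∣∣m-n∣ {d} {m} {n} d∣m d∣n with ≤-total m n
... | inj₁ m≤n = subst (d ∣_) (sym (m≤n⇒∣m-n∣≡n∸m m≤n)) (∣m∣n⇒∣n∸m m≤n d∣m d∣n)
... | inj₂ n≤m = subst (d ∣_) (trans (sym (m≤n⇒∣m-n∣≡n∸m n≤m)) (∣-∣-comm n m)) (∣m∣n⇒∣n∸m n≤m d∣n d∣m)

residues⇒∀ : ∀ p .{{_ : NonZero p}} (P : ℕ → Set) →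
             (∀ r k → P r → P (r + k * p)) → (∀ (r : Fin p) → P (toℕ r)) → ∀ i → P i
residues⇒∀ p P step residues i =
  subst P (sym (m≡m%n+[m/n]*n i p))
    (step (i % p) (i / p) (subst P (toℕ-fromℕ< (m%n<n i p)) (residues (fromℕ< (m%n<n i p)))))

-- Coprimality that survives translating both numbers by any multiple of m.
StablyCoprime : ℕ → ℕ → ℕ → Set
StablyCoprime m x y = Coprime x y × ∣ x - y ∣ ∣ m

stablyCoprime? : ∀ m x y → Dec (StablyCoprime m x y)
stablyCoprime? m x y = coprime? x y ×-dec (∣ x - y ∣ ∣? m)

stablyCoprime-translate : ∀ {m c x y} → m ∣ c →
                          StablyCoprime m x y → StablyCoprime m (c + x) (c + y)
stablyCoprime-translate {m} {c} {x} {y} m∣c (x⊥y , δ∣m) = c+x⊥c+y , subst (_∣ m) (sym δ≡) δ∣m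
  where
  δ≡ : ∣ c + x - c + y ∣ ≡ ∣ x - y ∣
  δ≡ = ∣m+n-m+o∣≡∣n-o∣ c x y

  c+x⊥c+y : Coprime (c + x) (c + y)
  c+x⊥c+y {d} (d∣c+x , d∣c+y) = x⊥y (∣m+n∣m⇒∣n d∣c+x d∣c , ∣m+n∣m⇒∣n d∣c+y d∣c)
    where
    d∣c : d ∣ c
    d∣c = ∣-trans (∣-trans (subst (d ∣_) δ≡ (∣m∣n⇒∣∣m-n∣ d∣c+x d∣c+y)) δ∣m) m∣c

blockLabel : ℕ → Fin 8 → ℕ
blockLabel i q = suc (8 * i + toℕ q)

-- 8i+5 is prime to 3 unless i ≡ 2 (mod 3); then 8i+3 and 8i+7 are both prime to 3,
-- and 5 divides at most one of them.
offsetChoice : (i≡2mod3 5∣8i+3 : Bool) → Fin 8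
offsetChoice false _     = # 4
offsetChoice true  false = # 2
offsetChoice true  true  = # 6

offsetRule : ℕ → Fin 8
offsetRule i = offsetChoice (i % 3 ≡ᵇ 2) ((8 * i + 3) % 5 ≡ᵇ 0)

offsetRule-periodic : ∀ r k → offsetRule (r + k * 15) ≡ offsetRule r
offsetRule-periodic r k = cong₂ (λ a b → offsetChoice (a ≡ᵇ 2) (b ≡ᵇ 0)) mod3 mod5
  where
  mod3 : (r + k * 15) % 3 ≡ r % 3
  mod3 = trans (cong (λ z → (r + z) % 3) (sym (*-assoc k 5 3))) ([m+kn]%n≡m%n r (k * 5) 3)

  eq5 : ∀ r k → 8 * (r + k * 15) + 3 ≡ 8 * r + 3 + k * 24 * 5
  eq5 = solve-∀

  mod5 : (8 * (r + k * 15) + 3) % 5 ≡ (8 * r + 3) % 5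
  mod5 = trans (cong (_% 5) (eq5 r k)) ([m+kn]%n≡m%n (8 * r + 3) (k * 24) 5)

ruleLabel : ℕ → ℕ
ruleLabel i = blockLabel i (offsetRule i)

blockLabel-translate : ∀ r k q → blockLabel (r + k * 15) q ≡ k * 120 + blockLabel r q
blockLabel-translate r k q = eq r k (toℕ q)
  where
  eq : ∀ r k a → suc (8 * (r + k * 15) + a) ≡ k * 120 + suc (8 * r + a)
  eq = solve-∀

ruleLabel-translate : ∀ r k → ruleLabel (r + k * 15) ≡ k * 120 + ruleLabel r
ruleLabel-translate r k =
  trans (cong (blockLabel (r + k * 15)) (offsetRule-periodic r k)) (blockLabel-translate r k (offsetRule r))

RulePendantsCoprime : ℕ → Set
RulePendantsCoprime i = ∀ q → ¬ q ≡ offsetRule i → StablyCoprime 120 (ruleLabel i) (blockLabel i q)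

RuleNeighboursCoprime : ℕ → Set
RuleNeighboursCoprime i = StablyCoprime 120 (ruleLabel i) (ruleLabel (suc i))

rulePendantsCoprime : ∀ i → RulePendantsCoprime i
rulePendantsCoprime = residues⇒∀ 15 RulePendantsCoprime translate (toWitness {a? = check} _)
  where
  check : Dec (∀ (r : Fin 15) → RulePendantsCoprime (toℕ r))
  check = all? λ r → all? λ q →
    ¬? (q ≟ offsetRule (toℕ r)) →-dec stablyCoprime? 120 (ruleLabel (toℕ r)) (blockLabel (toℕ r) q)

  translate : ∀ r k → RulePendantsCoprime r → RulePendantsCoprime (r + k * 15)
  translate r k pendants q q≢ =
    subst₂ (StablyCoprime 120) (sym (ruleLabel-translate r k)) (sym (blockLabel-translate r k q))
      (stablyCoprime-translate (n∣m*n k) (pendants q (λ q≡ → q≢ (trans q≡ (sym (offsetRule-periodic r k))))))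

ruleNeighboursCoprime : ∀ i → RuleNeighboursCoprime i
ruleNeighboursCoprime = residues⇒∀ 15 RuleNeighboursCoprime translate (toWitness {a? = check} _)
  where
  check : Dec (∀ (r : Fin 15) → RuleNeighboursCoprime (toℕ r))
  check = all? λ r → stablyCoprime? 120 (ruleLabel (toℕ r)) (ruleLabel (suc (toℕ r)))

  translate : ∀ r k → RuleNeighboursCoprime r → RuleNeighboursCoprime (r + k * 15)
  translate r k neighbours =
    subst₂ (StablyCoprime 120) (sym (ruleLabel-translate r k)) (sym (ruleLabel-translate (suc r) k))
      (stablyCoprime-translate (n∣m*n k) neighbours)

-- Hub 0 gets label 1, so the edge closing the cycle needs no arithmetic.
hubOffset : ℕ → Fin 8
hubOffset zero    = zero
hubOffset (suc i) = offsetRule (suc i)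

hubLabel : ℕ → ℕ
hubLabel i = blockLabel i (hubOffset i)

hub-pendant-coprime : ∀ i q → ¬ q ≡ hubOffset i → Coprime (hubLabel i) (blockLabel i q)
hub-pendant-coprime zero    q _   = 1-coprimeTo _
hub-pendant-coprime (suc i) q q≢ = proj₁ (rulePendantsCoprime (suc i) q q≢)

hub-suc-coprime : ∀ i → Coprime (hubLabel i) (hubLabel (suc i))
hub-suc-coprime zero    = 1-coprimeTo _
hub-suc-coprime (suc i) = proj₁ (ruleNeighboursCoprime (suc i))

toℕ-sucMod≡0⊎1+toℕ : ∀ {n} (i : Fin n) → toℕ (sucMod i) ≡ 0 ⊎ toℕ (sucMod i) ≡ suc (toℕ i)
toℕ-sucMod≡0⊎1+toℕ {suc zero}    zero    = inj₁ refl
toℕ-sucMod≡0⊎1+toℕ {suc (suc n)} zero    = inj₂ refl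
toℕ-sucMod≡0⊎1+toℕ {suc (suc n)} (suc i)
  with sucMod {suc n} i | toℕ-sucMod≡0⊎1+toℕ {suc n} i
... | zero  | _     = inj₁ refl
... | suc j | inj₁ ()
... | suc j | inj₂ e = inj₂ (cong suc e)

hub-sucMod-coprime : ∀ {n} (i : Fin n) → Coprime (hubLabel (toℕ i)) (hubLabel (toℕ (sucMod i)))
hub-sucMod-coprime i with toℕ (sucMod i) | toℕ-sucMod≡0⊎1+toℕ i
... | _ | inj₁ refl = Coprime.sym (1-coprimeTo _)
... | _ | inj₂ refl = hub-suc-coprime (toℕ i)

transpose-0-suc≢ : ∀ {n} (p : Fin (suc n)) j → ¬ transpose zero p ⟨$⟩ʳ suc j ≡ p
transpose-0-suc≢ p j eq with trans (sym (inverseˡ π {suc j})) (trans (cong (π ⟨$⟩ˡ_) eq) (inverseˡ π {zero}))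
  where π = transpose zero p
... | ()

hubPermutation : ℕ → Permutation′ 8
hubPermutation i = transpose zero (hubOffset i)

labelling : (n : ℕ) → (Fin n × Fin 8) ↔ Fin (8 * n)
labelling n = cast-id (*-comm n 8) ↔-∘ (↔-sym *↔× ↔-∘ Σ-↔ ↔-refl (λ {i} → hubPermutation (toℕ i)))

label-labelling : ∀ n i j →
  label (Inverse.to (labelling n) (i , j)) ≡ blockLabel (toℕ i) (hubPermutation (toℕ i) ⟨$⟩ʳ j)
label-labelling n i j = cong suc (trans (toℕ-cast (*-comm n 8) _) (toℕ-combine i _))

arc-coprime : ∀ n {u v} → HairyArc n 7 u v →
  Coprime (label (Inverse.to (labelling n) u)) (label (Inverse.to (labelling n) v))
arc-coprime n (cycleArc i) =
  subst₂ Coprime (sym (label-labelling n i zero)) (sym (label-labelling n (sucMod i) zero))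
    (hub-sucMod-coprime i)
arc-coprime n (pendantArc i j) =
  subst₂ Coprime (sym (label-labelling n i zero)) (sym (label-labelling n i (suc j)))
    (hub-pendant-coprime (toℕ i) _ (transpose-0-suc≢ (hubOffset (toℕ i)) j))

mainTheorem3 : (n : ℕ) → 3 ≤ n → IsCoprime (HairyCycle n 7) ((7 + 1) * n)
mainTheorem3 n _ = ↔⇒⤖ (labelling n) , λ where
  u v (inj₁ u→v) → arc-coprime n u→v
  u v (inj₂ v→u) → Coprime.sym (arc-coprime n v→u)
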